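{- For a graph $G$, $\gamma_{(2,2,2)}(G)=3$ if and only if $\gamma_{\times2,t}(G)=3$.
   Context: All graphs are finite and simple; $N(v)$ is the open neighbourhood and $f(S)=\sum_{u\in S}f(u)$. $\gamma_{(2,2,2)}(G)$ is the minimum of $\sum_v f(v)$ over functions $f:V(G)\to\{0,1,2\}$ with $f(N(v))\ge2$ for every vertex $v$; it is defined (and considered) only for graphs with minimum degree at least $1$. $\gamma_{\times2,t}(G)$ is the double total domination number: the minimum size of a set $D$ such that every vertex has at least two neighbours in $D$, defined for graphs of minimum degree at least $2$. -}

module Defs where

open import Data.Nat using (ℕ; zero; suc; _+_; _≤_)
open import Data.Fin using (Fin; zero; suc; toℕ)
open import Data.Bool using (Bool; true; false; if_then_else_; T; not)
open import Data.Product using (Σ; _×_; ∃-syntax)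
open import Relation.Binary.PropositionalEquality using (_≡_)

sumFin : (n : ℕ) → (Fin n → ℕ) → ℕ
sumFin zero    f = 0
sumFin (suc n) f = f zero + sumFin n (λ i → f (suc i))

record Graph (n : ℕ) : Set where
  field
    adj       : Fin n → Fin n → Bool
    adj-sym   : ∀ u v → adj u v ≡ adj v u
    adj-irrefl : ∀ v → adj v v ≡ false
open Graph public

nbrSum : ∀ {n} → Graph n → (Fin n → ℕ) → Fin n → ℕ
nbrSum {n} G f v = sumFin n (λ u → if adj G v u then f u else 0)

degree : ∀ {n} → Graph n → Fin n → ℕ
degree G v = nbrSum G (λ _ → 1) v

minDegree≥ : ∀ {n} → ℕ → Graph n → Set
minDegree≥ k G = ∀ v → k ≤ degree G v

IsMinimum : {A : Set} → (A → Set) → (A → ℕ) → ℕ → Set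
IsMinimum {A} P w k = (Σ A λ a → P a × w a ≡ k) × (∀ a → P a → k ≤ w a)

val3 : Fin 3 → ℕ
val3 = toℕ

IsDom222 : ∀ {n} → Graph n → (Fin n → Fin 3) → Set
IsDom222 G f = ∀ v → 2 ≤ nbrSum G (λ u → val3 (f u)) v

weight222 : ∀ {n} → (Fin n → Fin 3) → ℕ
weight222 {n} f = sumFin n (λ u → val3 (f u))

γ222≡ : ∀ {n} → Graph n → ℕ → Set
γ222≡ G k = IsMinimum (IsDom222 G) weight222 k

indicator : Bool → ℕ
indicator true  = 1
indicator false = 0

IsDTD : ∀ {n} → Graph n → (Fin n → Bool) → Set
IsDTD G D = ∀ v → 2 ≤ nbrSum G (λ u → indicator (D u)) v

card : ∀ {n} → (Fin n → Bool) → ℕ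
card {n} D = sumFin n (λ u → indicator (D u))

γx2t≡ : ∀ {n} → Graph n → ℕ → Set
γx2t≡ G k = IsMinimum (IsDTD G) card k

-- Call a weighting g : V → ℕ doubly totally dominating when g(N(v)) ≥ 2 for
-- every vertex v. On a nonempty graph such a g has total weight at least 3: some vertex u
-- has g(u) ≥ 1 (it lies in a neighbourhood of positive weight), and since N(u) and {u} are
-- disjoint the total weight is at least g(N(u)) + g(u) ≥ 3. This is the lower bound for
-- both parameters. A set D with |D| = 3 is a (2,2,2)-function of weight 3 via its
-- indicator; conversely in a (2,2,2)-function f of weight 3 every vertex has
-- f(u) ≤ 3 − f(N(u)) ≤ 1, so f is the indicator of a double total dominating set.
module Submission where

open import Defs
open import Data.Nat using (ℕ; zero; suc; _+_; _≤_; z≤n; s≤s)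
open import Data.Nat.Properties using (≤-refl; ≤-trans; +-mono-≤; +-monoʳ-≤; +-comm; +-assoc; +-cancelˡ-≤)
open import Data.Fin using (Fin; zero; suc)
open import Data.Bool using (Bool; true; false; if_then_else_)
open import Data.Product using (Σ; _,_; proj₁)
open import Relation.Binary.PropositionalEquality using (_≡_; refl; sym; trans; cong; cong₂; subst)
open import Function.Bundles using (_⇔_; mk⇔)

sumFin-cong : ∀ n {f g : Fin n → ℕ} → (∀ i → f i ≡ g i) → sumFin n f ≡ sumFin n g
sumFin-cong zero    eq = refl
sumFin-cong (suc n) eq = cong₂ _+_ (eq zero) (sumFin-cong n (λ i → eq (suc i)))

sumFin-mono : ∀ n {f g : Fin n → ℕ} → (∀ i → f i ≤ g i) → sumFin n f ≤ sumFin n g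
sumFin-mono zero    le = z≤n
sumFin-mono (suc n) le = +-mono-≤ (le zero) (sumFin-mono n (λ i → le (suc i)))

sumFin-mono-+-vanishing : ∀ n {f g : Fin n → ℕ} (v : Fin n) → f v ≡ 0 → (∀ i → f i ≤ g i) →
                          sumFin n f + g v ≤ sumFin n g
sumFin-mono-+-vanishing (suc n) {f} {g} zero fv≡0 le rewrite fv≡0 =
  subst (_≤ g zero + sumFin n (λ i → g (suc i)))
        (+-comm (g zero) (sumFin n (λ i → f (suc i))))
        (+-monoʳ-≤ (g zero) (sumFin-mono n (λ i → le (suc i))))
sumFin-mono-+-vanishing (suc n) {f} {g} (suc v) fv≡0 le =
  subst (_≤ g zero + sumFin n (λ i → g (suc i)))
        (sym (+-assoc (f zero) (sumFin n (λ i → f (suc i))) (g (suc v))))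
        (+-mono-≤ (le zero) (sumFin-mono-+-vanishing n v fv≡0 (λ i → le (suc i))))

sumFin-positive : ∀ n (f : Fin n → ℕ) → 1 ≤ sumFin n f → Σ (Fin n) λ u → 1 ≤ f u
sumFin-positive (suc n) f pos with f zero in eq
... | suc _ = zero , subst (1 ≤_) (sym eq) (s≤s z≤n)
... | zero with sumFin-positive n (λ i → f (suc i)) pos
...   | u , fu≥1 = suc u , fu≥1

if-then-else-0-≤ : ∀ (b : Bool) (x : ℕ) → (if b then x else 0) ≤ x
if-then-else-0-≤ true  x = ≤-refl
if-then-else-0-≤ false x = z≤n

if-then-else-0-positive : ∀ (b : Bool) (x : ℕ) → 1 ≤ (if b then x else 0) → 1 ≤ x
if-then-else-0-positive true x pos = pos

nbrSum-cong : ∀ {n} (G : Graph n) {f g : Fin n → ℕ} → (∀ u → f u ≡ g u) →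
              ∀ v → nbrSum G f v ≡ nbrSum G g v
nbrSum-cong {n} G eq v = sumFin-cong n (λ u → cong (if adj G v u then_else 0) (eq u))

nbrSum-+-self-≤-sumFin : ∀ {n} (G : Graph n) (g : Fin n → ℕ) (v : Fin n) →
                         nbrSum G g v + g v ≤ sumFin n g
nbrSum-+-self-≤-sumFin {n} G g v =
  sumFin-mono-+-vanishing n v
    (subst (λ b → (if b then g v else 0) ≡ 0) (sym (adj-irrefl G v)) refl)
    (λ u → if-then-else-0-≤ (adj G v u) (g u))

doubly-dominating-sumFin≥3 : ∀ {n} (G : Graph n) (g : Fin n → ℕ) →
                             (∀ v → 2 ≤ nbrSum G g v) → Fin n → 3 ≤ sumFin n g
doubly-dominating-sumFin≥3 {n} G g dom v with sumFin-positive n _ (≤-trans (s≤s z≤n) (dom v))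
... | u , pos = ≤-trans (+-mono-≤ (dom u) (if-then-else-0-positive (adj G v u) (g u) pos))
                        (nbrSum-+-self-≤-sumFin G g u)

doubly-dominating-self≤1 : ∀ {n} (G : Graph n) (g : Fin n → ℕ) →
                           (∀ v → 2 ≤ nbrSum G g v) → sumFin n g ≡ 3 → ∀ u → g u ≤ 1
doubly-dominating-self≤1 G g dom total≡3 u = +-cancelˡ-≤ 2 (g u) 1
  (≤-trans (+-mono-≤ (dom u) ≤-refl) (subst (nbrSum G g u + g u ≤_) total≡3 (nbrSum-+-self-≤-sumFin G g u)))

indicator₃ : Bool → Fin 3
indicator₃ true  = suc zero
indicator₃ false = zero

val3-indicator₃ : ∀ b → val3 (indicator₃ b) ≡ indicator b
val3-indicator₃ true  = refl
val3-indicator₃ false = refl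

is-one : Fin 3 → Bool
is-one zero             = false
is-one (suc zero)       = true
is-one (suc (suc zero)) = false

indicator-is-one : ∀ x → val3 x ≤ 1 → indicator (is-one x) ≡ val3 x
indicator-is-one zero             _ = refl
indicator-is-one (suc zero)       _ = refl
indicator-is-one (suc (suc zero)) (s≤s ())

IsDTD⇒IsDom222 : ∀ {n} (G : Graph n) (D : Fin n → Bool) → IsDTD G D →
                 IsDom222 G (λ u → indicator₃ (D u))
IsDTD⇒IsDom222 G D dtd v =
  subst (2 ≤_) (sym (nbrSum-cong G (λ u → val3-indicator₃ (D u)) v)) (dtd v)

weight222-indicator₃ : ∀ {n} (D : Fin n → Bool) → weight222 (λ u → indicator₃ (D u)) ≡ card D
weight222-indicator₃ {n} D = sumFin-cong n (λ u → val3-indicator₃ (D u))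

-- The hypothesis δ(G) ≥ 2 only makes γ_{×2,t} meaningful; the equivalence does not need it.
theorem3p14 : (n : ℕ) (G : Graph n) → minDegree≥ 2 G →
    γ222≡ G 3 ⇔ γx2t≡ G 3
theorem3p14 n G _ = mk⇔ to from
  where
  to : γ222≡ G 3 → γx2t≡ G 3
  to ((f , dom , weight≡3) , minimal) = (D , dtd , card≡3) , lower
    where
    D : Fin n → Bool
    D u = is-one (f u)
    indicator-D : ∀ u → indicator (D u) ≡ val3 (f u)
    indicator-D u = indicator-is-one (f u) (doubly-dominating-self≤1 G _ dom weight≡3 u)
    dtd : IsDTD G D
    dtd v = subst (2 ≤_) (sym (nbrSum-cong G indicator-D v)) (dom v)
    card≡3 : card D ≡ 3
    card≡3 = trans (sumFin-cong n indicator-D) weight≡3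
    lower : ∀ D′ → IsDTD G D′ → 3 ≤ card D′
    lower D′ dtd′ =
      subst (3 ≤_) (weight222-indicator₃ D′) (minimal _ (IsDTD⇒IsDom222 G D′ dtd′))
  from : γx2t≡ G 3 → γ222≡ G 3
  from ((D , dtd , card≡3) , _) =
    (_ , IsDTD⇒IsDom222 G D dtd , trans (weight222-indicator₃ D) card≡3) , lower
    where
    lower : ∀ f → IsDom222 G f → 3 ≤ weight222 f
    lower f dom = doubly-dominating-sumFin≥3 G _ dom
      (proj₁ (sumFin-positive n _ (subst (1 ≤_) (sym card≡3) (s≤s z≤n))))
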